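{- In the setting described in the context, for any integers $u,v$ with $d\nmid v$, there exists $k_{u,v}\in K$ such that $a^ub^v$ is conjugate in $G(a,b)$ to $k_{u,v}b^v$.
   Context: Let $p\geq5$ be a prime and $G\leq\mathrm{Sym}(\Omega)$ transitive with $|\Omega|=3p$, whose only non-trivial $G$-invariant partition is $\mathcal{B}=\{B_1,\dots,B_p\}$, $B_i=\{x_i,y_i,z_i\}$. Let $\overline{G}\leq\mathrm{Sym}(\mathcal{B})$ be the induced group and $K=\ker(G\to\overline{G})$. Assume $K\neq1$, $K$ contains no derangement (every element of $K$ fixes a point), every minimal normal subgroup of $G$ contained in $K$ is an elementary abelian $3$-group, and $K$ contains no involution. Assume $\overline{G}$ is solvable and non-cyclic: $\overline{G}=\langle\alpha\rangle\rtimes\langle\beta\rangle\leq\mathrm{AGL}(1,p)$ with $\alpha=(B_1\,B_2\,\cdots\,B_p)$, $o(\beta)=d\geq2$, $d\mid p-1$, $\beta$ fixing $B_1$, $\beta\alpha\beta^{ -1}=\alpha^t$ with $\gcd(t,p)=1$. Let $a=(x_1\,\cdots\,x_p)(y_1\,\cdots\,y_p)(z_1\,\cdots\,z_p)\in G$ (with image $\alpha$) and $b\in G$ with image $\beta$, and assume $b$ fixes every point of $B_1$. Let $G(a,b)=\langle K,a,b\rangle$. -}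

module Defs where

open import Level using (0ℓ)
open import Data.Nat using (ℕ; zero; suc; _+_; _*_; _^_; _%_; _<_; NonZero)
open import Data.Integer using (ℤ; +_; -[1+_])
open import Data.Fin using (Fin; toℕ)
open import Data.Product using (_×_; _,_; proj₁; proj₂; Σ; ∃; ∃-syntax)
open import Data.Sum using (_⊎_)
open import Relation.Nullary using (¬_)
open import Relation.Binary.PropositionalEquality using (_≡_)
open import Relation.Binary.Structures using (IsEquivalence)
open import Function.Bundles using (_↔_; Inverse)
open import Function.Construct.Composition using (_↔-∘_)
open import Function.Construct.Symmetry using (↔-sym)
open import Function.Construct.Identity using (↔-id)

-- The point set Ω = {x_i, y_i, z_i : i} with |Ω| = 3p.
-- (i , 0) = x_{i+1}, (i , 1) = y_{i+1}, (i , 2) = z_{i+1}  (i = 0 … p-1),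
-- so the block B_{i+1} is {(i , j) : j ∈ Fin 3}.
Ω : ℕ → Set
Ω p = Fin p × Fin 3

Sym : ℕ → Set
Sym p = Ω p ↔ Ω p

module _ {p : ℕ} where

  app : Sym p → Ω p → Ω p
  app g = Inverse.to g

  infix 4 _≈_
  _≈_ : Sym p → Sym p → Set
  g ≈ h = ∀ x → app g x ≡ app h x

  -- product g · h = "first h, then g"
  infixl 7 _·_
  _·_ : Sym p → Sym p → Sym p
  g · h = g ↔-∘ h

  e : Sym p
  e = ↔-id (Ω p)

  _⁻¹ : Sym p → Sym p
  g ⁻¹ = ↔-sym g

  powℕ : Sym p → ℕ → Sym p
  powℕ g zero    = e
  powℕ g (suc n) = g · powℕ g n

  _^ᶻ_ : Sym p → ℤ → Sym p
  g ^ᶻ (+ n)     = powℕ g n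
  g ^ᶻ -[1+ n ]  = powℕ (g ⁻¹) (suc n)

  SubSet : Set₁
  SubSet = Sym p → Set

  _⊆_ : SubSet → SubSet → Set
  H ⊆ L = ∀ g → H g → L g

  record IsSubgroup (H : SubSet) : Set where
    field
      resp≈ : ∀ {g h} → g ≈ h → H g → H h
      has-e : H e
      ·-closed : ∀ {g h} → H g → H h → H (g · h)
      ⁻¹-closed : ∀ {g} → H g → H (g ⁻¹)

  record IsNormalSubgroupOf (N G : SubSet) : Set where
    field
      subgroup : IsSubgroup N
      sub : N ⊆ G
      conj-closed : ∀ {g n} → G g → N n → N (g · n · g ⁻¹)

  Trivial : SubSet → Set
  Trivial H = ∀ h → H h → h ≈ e

  record IsMinimalNormal (N G : SubSet) : Set₁ where
    field
      normal : IsNormalSubgroupOf N G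
      nontrivial : ¬ Trivial N
      minimal : ∀ M → IsNormalSubgroupOf M G → M ⊆ N → Trivial M ⊎ N ⊆ M

  -- elementary abelian 3-group: abelian of exponent 3
  -- (the trivial group is excluded separately, minimal normal subgroups being nontrivial)
  IsElemAbelian3 : SubSet → Set
  IsElemAbelian3 N =
    (∀ g h → N g → N h → g · h ≈ h · g) × (∀ g → N g → powℕ g 3 ≈ e)

  Transitive : SubSet → Set
  Transitive G = ∀ x y → ∃[ g ] (G g × app g x ≡ y)

  -- G-invariant partitions of Ω, given by their equivalence relation
  -- (x ~ y iff x and y lie in the same part)
  record InvariantPartition (G : SubSet) (R : Ω p → Ω p → Set) : Set where
    field
      isEquivalence : IsEquivalence R
      invariant : ∀ g x y → G g → R x y → R (app g x) (app g y)

  NonTrivialPartition : (Ω p → Ω p → Set) → Set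
  NonTrivialPartition R = ¬ (∀ x y → R x y → x ≡ y) × ¬ (∀ x y → R x y)

  SameBlock : Ω p → Ω p → Set
  SameBlock x y = proj₁ x ≡ proj₁ y

  blk : Sym p → Ω p → ℕ
  blk g x = toℕ (proj₁ (app g x))

  Ker : SubSet → SubSet
  Ker G g = G g × (∀ x → proj₁ (app g x) ≡ proj₁ x)

  Derangement : Sym p → Set
  Derangement g = ∀ x → ¬ (app g x ≡ x)

  data Gen (K : SubSet) (a b : Sym p) : SubSet where
    gen-K : ∀ {k} → K k → Gen K a b k
    gen-a : Gen K a b a
    gen-b : Gen K a b b
    gen-e : Gen K a b e
    gen-· : ∀ {g h} → Gen K a b g → Gen K a b h → Gen K a b (g · h)
    gen-⁻¹ : ∀ {g} → Gen K a b g → Gen K a b (g ⁻¹)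
    gen-≈ : ∀ {g h} → g ≈ h → Gen K a b g → Gen K a b h

module Submission where

open import Defs
open import Data.Nat using (ℕ; suc; _+_; _*_; _^_; _%_; _∸_; _<_; _≤_; NonZero)
open import Data.Nat.Primality using (Prime)
open import Data.Integer using (ℤ; +_)
open import Data.Fin using (Fin; toℕ)
open import Data.Product using (_×_; _,_; proj₁; proj₂; ∃-syntax)
open import Relation.Nullary using (¬_)
open import Relation.Binary.PropositionalEquality using (_≡_)
open import Function.Bundles using (_⇔_)
import Data.Nat.Divisibility as ℕD
import Data.Integer.Divisibility as ℤD

open import Level using (0ℓ)
open import Data.Nat using (zero; z≤n; s≤s; _≟_; ≢-nonZero; >-nonZero; _/_)
open import Data.Nat.Properties
  using ( +-comm; *-comm; *-zeroʳ; *-identityˡ; *-identityʳ; +-identityʳ; +-identityˡ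
        ; ^-distribˡ-+-*; ^-*-assoc; suc-pred; n≢0⇒n>0; ≤-trans )
open import Data.Nat.DivMod
  using ( %-distribˡ-+; %-distribˡ-*; m%n%n≡m%n; [m+kn]%n≡m%n; m<n⇒m%n≡m; m%n<n; m*n%n≡0
        ; m≡m%n+[m/n]*n )
open import Data.Nat.Coprimality using (prime⇒coprime; coprime-Bézout)
open import Data.Nat.GCD using (module Bézout)
open import Data.Nat.Tactic.RingSolver using (solve-∀)
open import Data.Integer using (-[1+_]; ∣_∣)
open import Data.Fin.Properties using (toℕ<n; toℕ-injective)
open import Data.Empty using (⊥-elim)
open import Relation.Nullary using (yes; no)
open import Function.Base using (_∘_; flip)
open import Relation.Binary.Bundles using (Setoid)
open import Relation.Binary.PropositionalEquality
  using (_≢_; refl; sym; trans; cong; cong₂; subst; module ≡-Reasoning)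
open import Function.Bundles using (Inverse)
import Relation.Binary.Reasoning.Setoid as SetoidReasoning

-- On block indices, read in ℤ/p, a acts as i ↦ i + 1 and b as i ↦ t i, so a^u b^v acts as
-- i ↦ S i + c with S = t^v, and S ≠ 1 because t has order d and d ∤ v.  An affine map of
-- slope S ≠ 1 has a fixed point; conjugating by a power of a moves it to 0, after which
-- the conjugate permutes the blocks exactly as b^v does, so it differs from b^v by an
-- element of K.

module Residues (p : ℕ) .{{_ : NonZero p}} where

  infix 4 _≋_
  _≋_ : ℕ → ℕ → Set
  m ≋ n = m % p ≡ n % p

  ≋-setoid : Setoid 0ℓ 0ℓ
  ≋-setoid = record
    { Carrier = ℕ ; _≈_ = _≋_
    ; isEquivalence = record { refl = refl ; sym = sym ; trans = trans } }

  module ≋-Reasoning = SetoidReasoning ≋-setoid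

  ≡⇒≋ : ∀ {m n} → m ≡ n → m ≋ n
  ≡⇒≋ = cong (_% p)

  %-≋ : ∀ m → m % p ≋ m
  %-≋ m = m%n%n≡m%n m p

  +-multiple-≋ : ∀ m k → m + k * p ≋ m
  +-multiple-≋ m k = [m+kn]%n≡m%n m k p

  +-≋ : ∀ {m m′ n n′} → m ≋ m′ → n ≋ n′ → m + n ≋ m′ + n′
  +-≋ {m} {m′} {n} {n′} m≋m′ n≋n′ = begin
    (m + n) % p                ≡⟨ %-distribˡ-+ m n p ⟩
    (m % p + n % p) % p        ≡⟨ cong₂ (λ x y → (x + y) % p) m≋m′ n≋n′ ⟩
    (m′ % p + n′ % p) % p      ≡⟨ %-distribˡ-+ m′ n′ p ⟨
    (m′ + n′) % p              ∎
    where open ≡-Reasoning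

  *-≋ : ∀ {m m′ n n′} → m ≋ m′ → n ≋ n′ → m * n ≋ m′ * n′
  *-≋ {m} {m′} {n} {n′} m≋m′ n≋n′ = begin
    (m * n) % p                ≡⟨ %-distribˡ-* m n p ⟩
    (m % p * (n % p)) % p      ≡⟨ cong₂ (λ x y → (x * y) % p) m≋m′ n≋n′ ⟩
    (m′ % p * (n′ % p)) % p    ≡⟨ %-distribˡ-* m′ n′ p ⟨
    (m′ * n′) % p              ∎
    where open ≡-Reasoning

  ^-≋1 : ∀ {m} → m ≋ 1 → ∀ n → m ^ n ≋ 1
  ^-≋1 m≋1 zero    = refl
  ^-≋1 m≋1 (suc n) = *-≋ m≋1 (^-≋1 m≋1 n)

  ^-inverse : ∀ {m n} → m * n ≋ 1 → ∀ k → m ^ k * n ^ k ≋ 1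
  ^-inverse m*n≋1 zero = refl
  ^-inverse {m} {n} m*n≋1 (suc k) = begin
    m * m ^ k * (n * n ^ k)     ≡⟨ interchange m n (m ^ k) (n ^ k) ⟩
    m * n * (m ^ k * n ^ k)     ≈⟨ *-≋ m*n≋1 (^-inverse m*n≋1 k) ⟩
    1                           ∎
    where
      open ≋-Reasoning
      interchange : ∀ a b c d → a * c * (b * d) ≡ a * b * (c * d)
      interchange = solve-∀

  toℕ-≋-injective : ∀ {i j : Fin p} → toℕ i ≋ toℕ j → i ≡ j
  toℕ-≋-injective {i} {j} i≋j = toℕ-injective (begin
    toℕ i        ≡⟨ m<n⇒m%n≡m (toℕ<n i) ⟨
    toℕ i % p    ≡⟨ i≋j ⟩
    toℕ j % p    ≡⟨ m<n⇒m%n≡m (toℕ<n j) ⟩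
    toℕ j        ∎)
    where open ≡-Reasoning

  toℕ≡%⇒≋ : ∀ (i : Fin p) n → toℕ i ≡ n % p → toℕ i ≋ n
  toℕ≡%⇒≋ i n i≡n%p = trans (m<n⇒m%n≡m (toℕ<n i)) i≡n%p

  order-∣ : ∀ {t d} .{{_ : NonZero d}} → t ^ d ≋ 1 → (∀ m → 0 < m → m < d → ¬ t ^ m ≋ 1) →
            ∀ n → t ^ n ≋ 1 → d ℕD.∣ n
  order-∣ {t} {d} tᵈ≋1 minimal n tⁿ≋1 with n % d ≟ 0
  ... | yes r≡0 = ℕD.m%n≡0⇒n∣m n d r≡0
  ... | no r≢0  = ⊥-elim (minimal (n % d) (n≢0⇒n>0 r≢0) (m%n<n n d) tʳ≋1)
    where
      open ≋-Reasoning
      tʳ≋1 : t ^ (n % d) ≋ 1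
      tʳ≋1 = begin
        t ^ (n % d)                      ≡⟨ *-identityʳ _ ⟨
        t ^ (n % d) * 1                  ≈⟨ *-≋ {t ^ (n % d)} refl (^-≋1 tᵈ≋1 (n / d)) ⟨
        t ^ (n % d) * (t ^ d) ^ (n / d)  ≡⟨ cong (t ^ (n % d) *_) (^-*-assoc t d (n / d)) ⟩
        t ^ (n % d) * t ^ (d * (n / d))  ≡⟨ ^-distribˡ-+-* t (n % d) (d * (n / d)) ⟨
        t ^ (n % d + d * (n / d))        ≡⟨ cong (λ k → t ^ (n % d + k)) (*-comm d (n / d)) ⟩
        t ^ (n % d + n / d * d)          ≡⟨ cong (t ^_) (m≡m%n+[m/n]*n n d) ⟨
        t ^ n                            ≈⟨ tⁿ≋1 ⟩
        1                                ∎

  -- Bézout for p and m % p; in the +- case p ∸ 1 stands for −1.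
  inverse-exists : Prime p → ∀ {m} → ¬ m ≋ 0 → ∃[ m′ ] m′ * m ≋ 1
  inverse-exists p-prime {m} m≉0 =
    inverse (coprime-Bézout (prime⇒coprime p-prime {{≢-nonZero r≢0}} (m%n<n m p)))
    where
      open ≋-Reasoning
      r = m % p
      r≢0 : r ≢ 0
      r≢0 r≡0 = m≉0 (trans r≡0 (sym (m*n%n≡0 0 p)))
      inverse : Bézout.Identity 1 p r → ∃[ m′ ] m′ * m ≋ 1
      inverse (Bézout.-+ x y 1+xp≡yr) = y , (begin
        y * m        ≈⟨ *-≋ {y} refl (%-≋ m) ⟨
        y * r        ≡⟨ 1+xp≡yr ⟨
        1 + x * p    ≈⟨ +-multiple-≋ 1 x ⟩
        1            ∎)
      inverse (Bézout.+- x y 1+yr≡xp) = y * (p ∸ 1) , (begin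
        y * (p ∸ 1) * m                  ≈⟨ *-≋ {y * (p ∸ 1)} refl (%-≋ m) ⟨
        y * (p ∸ 1) * r                  ≈⟨ +-multiple-≋ _ 1 ⟨
        y * (p ∸ 1) * r + 1 * p          ≡⟨ cong (λ P → y * (p ∸ 1) * r + 1 * P) (suc-pred p) ⟨
        y * (p ∸ 1) * r + 1 * suc (p ∸ 1) ≡⟨ regroup y r (p ∸ 1) ⟩
        (1 + y * r) * (p ∸ 1) + 1        ≡⟨ cong (λ z → z * (p ∸ 1) + 1) 1+yr≡xp ⟩
        x * p * (p ∸ 1) + 1              ≡⟨ regroup′ x p (p ∸ 1) ⟩
        1 + x * (p ∸ 1) * p              ≈⟨ +-multiple-≋ 1 (x * (p ∸ 1)) ⟩
        1                                ∎)
        where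
          regroup : ∀ y r q → y * q * r + 1 * suc q ≡ (1 + y * r) * q + 1
          regroup = solve-∀
          regroup′ : ∀ x p q → x * p * q + 1 ≡ 1 + x * q * p
          regroup′ = solve-∀

  s*w≋c+w-solvable : Prime p → ∀ {s} → ¬ s ≋ 1 → ∀ c → ∃[ w ] s * w ≋ c + w
  s*w≋c+w-solvable p-prime {s} s≉1 c = w , (begin
    s * w                           ≈⟨ +-multiple-≋ (s * w) w ⟨
    s * w + w * p                   ≡⟨ cong (λ P → s * w + w * P) (suc-pred p) ⟨
    s * w + w * suc (p ∸ 1)         ≡⟨ regroup s w (p ∸ 1) ⟩
    (s + (p ∸ 1)) * w + w           ≡⟨⟩
    D * (D′ * c) + w                ≡⟨ cong (_+ w) (reassoc D D′ c) ⟩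
    D′ * D * c + w                  ≈⟨ +-≋ (*-≋ D′D≋1 (refl {x = c % p})) (refl {x = w % p}) ⟩
    1 * c + w                       ≡⟨ cong (_+ w) (*-identityˡ c) ⟩
    c + w                           ∎)
    where
      open ≋-Reasoning
      D = s + (p ∸ 1)
      regroup : ∀ s w q → s * w + w * suc q ≡ (s + q) * w + w
      regroup = solve-∀
      reassoc : ∀ a b c → a * (b * c) ≡ b * a * c
      reassoc = solve-∀
      D≉0 : ¬ D ≋ 0
      D≉0 D≋0 = s≉1 (begin
        s                  ≈⟨ +-multiple-≋ s 1 ⟨
        s + 1 * p          ≡⟨ cong (λ P → s + 1 * P) (suc-pred p) ⟨
        s + 1 * suc (p ∸ 1) ≡⟨ regroup′ s (p ∸ 1) ⟩
        D + 1              ≈⟨ +-≋ D≋0 (refl {x = 1 % p}) ⟩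
        0 + 1              ∎)
        where
          regroup′ : ∀ s q → s + 1 * suc q ≡ (s + q) + 1
          regroup′ = solve-∀
      D′ = proj₁ (inverse-exists p-prime D≉0)
      D′D≋1 = proj₂ (inverse-exists p-prime D≉0)
      w = D′ * c

module _ {p : ℕ} {H : SubSet {p}} (H-subgroup : IsSubgroup H) where
  open IsSubgroup H-subgroup

  powℕ-closed : ∀ {g} → H g → ∀ n → H (powℕ g n)
  powℕ-closed Hg zero    = has-e
  powℕ-closed Hg (suc n) = ·-closed Hg (powℕ-closed Hg n)

  ^ᶻ-closed : ∀ {g} → H g → ∀ u → H (g ^ᶻ u)
  ^ᶻ-closed Hg (+ n)    = powℕ-closed Hg n
  ^ᶻ-closed Hg -[1+ n ] = powℕ-closed (⁻¹-closed Hg) (suc n)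

Gen-isSubgroup : ∀ {p} {K : SubSet {p}} {a b} → IsSubgroup (Gen K a b)
Gen-isSubgroup = record { resp≈ = gen-≈ ; has-e = gen-e ; ·-closed = gen-· ; ⁻¹-closed = gen-⁻¹ }

≈-·⁻¹· : ∀ {p} (g h : Sym p) → g ≈ g · h ⁻¹ · h
≈-·⁻¹· g h x = sym (cong (app g) (Inverse.strictlyInverseʳ h x))

module AffineBlocks (p : ℕ) .{{_ : NonZero p}} where
  open Residues p

  index : Ω p → ℕ
  index x = toℕ (proj₁ x)

  record Affine (g : Sym p) (s c : ℕ) : Set where
    constructor affine
    field blk-≋ : ∀ x → blk g x ≋ s * index x + c
  open Affine public

  Affine-cong : ∀ {g s s′ c c′} → s ≋ s′ → c ≋ c′ → Affine g s c → Affine g s′ c′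
  Affine-cong s≋s′ c≋c′ A = affine λ x → trans (blk-≋ A x) (+-≋ (*-≋ s≋s′ refl) c≋c′)

  Affine-e : Affine e 1 0
  Affine-e = affine λ x → ≡⇒≋ (sym (trans (+-identityʳ _) (*-identityˡ _)))

  Affine-· : ∀ {g h s s′ c c′} → Affine g s c → Affine h s′ c′ →
             Affine (g · h) (s * s′) (s * c′ + c)
  Affine-· {g} {h} {s} {s′} {c} {c′} A B = affine λ x → begin
    blk g (app h x)                ≈⟨ blk-≋ A (app h x) ⟩
    s * blk h x + c                ≈⟨ +-≋ (*-≋ {s} refl (blk-≋ B x)) (refl {x = c % p}) ⟩
    s * (s′ * index x + c′) + c    ≡⟨ distrib s s′ c c′ (index x) ⟩
    s * s′ * index x + (s * c′ + c) ∎
    where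
      open ≋-Reasoning
      distrib : ∀ s s′ c c′ y → s * (s′ * y + c′) + c ≡ s * s′ * y + (s * c′ + c)
      distrib = solve-∀

  Affine-preimage : ∀ {g s c} → Affine g s c → ∀ x → index x ≋ s * blk (g ⁻¹) x + c
  Affine-preimage {g} {s} {c} A x =
    subst (λ y → index y ≋ s * blk (g ⁻¹) x + c) (Inverse.strictlyInverseˡ g x)
          (blk-≋ A (app (g ⁻¹) x))

  -- In ℤ/p the inverse is i ↦ s′ (i − c), and p ∸ 1 stands for −1.
  Affine-⁻¹ : ∀ {g s s′ c} → s′ * s ≋ 1 → Affine g s c →
              Affine (g ⁻¹) s′ (s′ * (c * (p ∸ 1)))
  Affine-⁻¹ {g} {s} {s′} {c} s′s≋1 A = affine λ x → let y = blk (g ⁻¹) x in sym (begin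
    s′ * index x + s′ * (c * (p ∸ 1))          ≈⟨ +-≋ (*-≋ {s′} refl (Affine-preimage A x)) refl ⟩
    s′ * (s * y + c) + s′ * (c * (p ∸ 1))      ≡⟨ regroup s′ s y c (p ∸ 1) ⟩
    s′ * s * y + s′ * c * suc (p ∸ 1)          ≡⟨ cong (λ P → s′ * s * y + s′ * c * P) (suc-pred p) ⟩
    s′ * s * y + s′ * c * p                    ≈⟨ +-multiple-≋ (s′ * s * y) (s′ * c) ⟩
    s′ * s * y                                 ≈⟨ *-≋ s′s≋1 (refl {x = y % p}) ⟩
    1 * y                                      ≡⟨ *-identityˡ y ⟩
    y                                          ∎)
    where
      open ≋-Reasoning
      regroup : ∀ s′ s y c q → s′ * (s * y + c) + s′ * (c * q) ≡ s′ * s * y + s′ * c * suc q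
      regroup = solve-∀

  Affine-powℕ-linear : ∀ {g s} → Affine g s 0 → ∀ n → Affine (powℕ g n) (s ^ n) 0
  Affine-powℕ-linear A zero    = Affine-e
  Affine-powℕ-linear {s = s} A (suc n) =
    Affine-cong refl (≡⇒≋ (trans (+-identityʳ (s * 0)) (*-zeroʳ s)))
                (Affine-· A (Affine-powℕ-linear A n))

  Affine-powℕ-translation : ∀ {g c} → Affine g 1 c → ∀ n → Affine (powℕ g n) 1 (n * c)
  Affine-powℕ-translation A zero    = Affine-e
  Affine-powℕ-translation {c = c} A (suc n) =
    Affine-cong refl (≡⇒≋ (regroup n c)) (Affine-· A (Affine-powℕ-translation A n))
    where
      regroup : ∀ n c → 1 * (n * c) + c ≡ c + n * c
      regroup = solve-∀

  Affine-^ᶻ-translation : ∀ {g c} → Affine g 1 c → ∀ u → ∃[ c′ ] Affine (g ^ᶻ u) 1 c′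
  Affine-^ᶻ-translation A (+ n)    = _ , Affine-powℕ-translation A n
  Affine-^ᶻ-translation A -[1+ n ] = _ , Affine-powℕ-translation (Affine-⁻¹ refl A) (suc n)

  Affine-^ᶻ-linear : ∀ {g s s′} → Affine g s 0 → s′ * s ≋ 1 →
                     ∀ v → ∃[ S ] (Affine (g ^ᶻ v) S 0 × (S ≋ 1 → s ^ ∣ v ∣ ≋ 1))
  Affine-^ᶻ-linear A s′s≋1 (+ n)    = _ , Affine-powℕ-linear A n , λ sⁿ≋1 → sⁿ≋1
  Affine-^ᶻ-linear {s = s} {s′} A s′s≋1 -[1+ n ] =
    _ , Affine-powℕ-linear A⁻¹ (suc n) , sⁿ≋1
    where
      open ≋-Reasoning
      A⁻¹ : Affine (_ ⁻¹) s′ 0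
      A⁻¹ = Affine-cong refl (≡⇒≋ (*-zeroʳ s′)) (Affine-⁻¹ s′s≋1 A)
      sⁿ≋1 : s′ ^ suc n ≋ 1 → s ^ suc n ≋ 1
      sⁿ≋1 s′ⁿ≋1 = begin
        s ^ suc n                    ≡⟨ *-identityʳ _ ⟨
        s ^ suc n * 1                ≈⟨ *-≋ {s ^ suc n} refl s′ⁿ≋1 ⟨
        s ^ suc n * s′ ^ suc n       ≈⟨ ^-inverse {s} {s′} (trans (≡⇒≋ (*-comm s s′)) s′s≋1) (suc n) ⟩
        1                            ∎

  -- Conjugating by the translation a^w moves the fixed block −w of h to 0.
  conjugate-to-linear : Prime p → ∀ {a h s c} → Affine a 1 1 → Affine h s c → ¬ s ≋ 1 →
                        ∃[ w ] Affine (powℕ a w · h · powℕ a w ⁻¹) s 0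
  conjugate-to-linear p-prime {a} {h} {s} {c} A H s≉1 =
    w , affine λ x → let y = blk (powℕ a w ⁻¹) x in begin
    blk (powℕ a w) (app h (app (powℕ a w ⁻¹) x))  ≈⟨ blk-≋ Aʷ _ ⟩
    1 * blk h (app (powℕ a w ⁻¹) x) + w * 1       ≈⟨ +-≋ (*-≋ {1} refl (blk-≋ H _)) refl ⟩
    1 * (s * y + c) + w * 1                       ≡⟨ regroup s y c w ⟩
    s * y + (c + w)                               ≈⟨ +-≋ (refl {x = (s * y) % p}) s*w≋c+w ⟨
    s * y + s * w                                 ≡⟨ regroup′ s y w ⟩
    s * (1 * y + w * 1)                           ≈⟨ *-≋ {s} refl (Affine-preimage Aʷ x) ⟨
    s * index x                                   ≡⟨ +-identityʳ _ ⟨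
    s * index x + 0                               ∎
    where
      open ≋-Reasoning
      w = proj₁ (s*w≋c+w-solvable p-prime s≉1 c)
      s*w≋c+w = proj₂ (s*w≋c+w-solvable p-prime s≉1 c)
      Aʷ = Affine-powℕ-translation A w
      regroup : ∀ s y c w → 1 * (s * y + c) + w * 1 ≡ s * y + (c + w)
      regroup = solve-∀
      regroup′ : ∀ s y w → s * y + s * w ≡ s * (1 * y + w * 1)
      regroup′ = solve-∀

  same-affine⇒fixes-blocks : ∀ {g h s c} → Affine g s c → Affine h s c →
                             ∀ x → proj₁ (app (g · h ⁻¹) x) ≡ proj₁ x
  same-affine⇒fixes-blocks {h = h} A B x =
    toℕ-≋-injective (trans (blk-≋ A (app (h ⁻¹) x)) (sym (Affine-preimage B x)))

  conjugate-into-kernel : Prime p → ∀ {G a h l s c} → IsSubgroup G → G a → G h → G l →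
                          Affine a 1 1 → Affine h s c → Affine l s 0 → ¬ s ≋ 1 →
                          ∃[ w ] Ker G (powℕ a w · h · powℕ a w ⁻¹ · l ⁻¹)
  conjugate-into-kernel p-prime {G} G-subgroup Ga Gh Gl A H L s≉1 =
    w , (Gk , same-affine⇒fixes-blocks conj-linear L)
    where
      open IsSubgroup G-subgroup
      w = proj₁ (conjugate-to-linear p-prime A H s≉1)
      conj-linear = proj₂ (conjugate-to-linear p-prime A H s≉1)
      Gaʷ = powℕ-closed G-subgroup Ga w
      Gk = ·-closed (·-closed (·-closed Gaʷ Gh) (⁻¹-closed Gaʷ)) (⁻¹-closed Gl)

lemma7p1 : ∀ (p : ℕ) .{{_ : NonZero p}} → Prime p → 5 ≤ p →
    ∀ (G : SubSet {p}) → IsSubgroup G → Transitive G →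
    InvariantPartition G SameBlock →
    (∀ (R : Ω p → Ω p → Set) → InvariantPartition G R → NonTrivialPartition R →
    ∀ x y → R x y ⇔ SameBlock x y) →
    ¬ Trivial (Ker G) →
    (∀ k → Ker G k → ¬ Derangement k) →
    (∀ N → IsMinimalNormal N G → N ⊆ Ker G → IsElemAbelian3 N) →
    (∀ k → Ker G k → k · k ≈ e → k ≈ e) →
    ∀ (d t : ℕ) → 2 ≤ d → d ℕD.∣ (p ∸ 1) →
    (t ^ d) % p ≡ 1 → (∀ m → 0 < m → m < d → ¬ ((t ^ m) % p ≡ 1)) →
    (∀ g → G g → ∃[ m ] ∃[ c ] (∀ x → blk g x ≡ (t ^ m * toℕ (proj₁ x) + c) % p)) →
    ∀ (a b : Sym p) →
    G a → (∀ x → blk a x ≡ suc (toℕ (proj₁ x)) % p) → (∀ x → proj₂ (app a x) ≡ proj₂ x) →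
    G b → (∀ x → blk b x ≡ (t * toℕ (proj₁ x)) % p) →
    (∀ x → toℕ (proj₁ x) ≡ 0 → app b x ≡ x) →
    ∀ (u v : ℤ) → ¬ ((+ d) ℤD.∣ v) →
    ∃[ k ] (Ker G k × ∃[ g ] (Gen (Ker G) a b g ×
    (g · (a ^ᶻ u · b ^ᶻ v) · g ⁻¹ ≈ k · b ^ᶻ v)))
lemma7p1 p p-prime 5≤p G G-subgroup _ _ _ _ _ _ _ d t 2≤d _ tᵈ%p≡1 t-order _
         a b Ga a-blocks _ Gb b-blocks _ u v d∤v =
  _ , k∈K , powℕ a w , powℕ-closed Gen-isSubgroup gen-a w ,
  ≈-·⁻¹· (powℕ a w · (a ^ᶻ u · b ^ᶻ v) · powℕ a w ⁻¹) (b ^ᶻ v)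
  where
    open Residues p
    open AffineBlocks p
    instance
      d≢0 : NonZero d
      d≢0 = >-nonZero (≤-trans (s≤s z≤n) 2≤d)
    1%p≡1 : 1 % p ≡ 1
    1%p≡1 = m<n⇒m%n≡m (≤-trans (s≤s (s≤s z≤n)) 5≤p)
    tᵈ≋1 : t ^ d ≋ 1
    tᵈ≋1 = trans tᵈ%p≡1 (sym 1%p≡1)
    tᵈ⁻¹*t≋1 : t ^ (d ∸ 1) * t ≋ 1
    tᵈ⁻¹*t≋1 = trans (≡⇒≋ (trans (*-comm _ t) (cong (t ^_) (suc-pred d)))) tᵈ≋1
    a-translation : Affine a 1 1
    a-translation = affine λ x →
      trans (toℕ≡%⇒≋ _ _ (a-blocks x)) (≡⇒≋ (trans (+-comm 1 _) (cong (_+ 1) (sym (*-identityˡ _)))))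
    b-linear : Affine b t 0
    b-linear = affine λ x → trans (toℕ≡%⇒≋ _ _ (b-blocks x)) (≡⇒≋ (sym (+-identityʳ _)))
    bᵛ-slope = Affine-^ᶻ-linear {s′ = t ^ (d ∸ 1)} b-linear tᵈ⁻¹*t≋1 v
    S : ℕ
    S = proj₁ bᵛ-slope
    bᵛ-linear : Affine (b ^ᶻ v) S 0
    bᵛ-linear = proj₁ (proj₂ bᵛ-slope)
    S≉1 : ¬ S ≋ 1
    S≉1 = d∤v ∘ order-∣ tᵈ≋1 (λ m 0<m m<d → t-order m 0<m m<d ∘ flip trans 1%p≡1) ∣ v ∣
              ∘ proj₂ (proj₂ bᵛ-slope)
    c : ℕ
    c = proj₁ (Affine-^ᶻ-translation a-translation u)
    aᵘbᵛ-affine : Affine (a ^ᶻ u · b ^ᶻ v) S c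
    aᵘbᵛ-affine = Affine-cong (≡⇒≋ (*-identityˡ S)) (≡⇒≋ (+-identityˡ c))
                    (Affine-· (proj₂ (Affine-^ᶻ-translation a-translation u)) bᵛ-linear)
    Gbᵛ : G (b ^ᶻ v)
    Gbᵛ = ^ᶻ-closed G-subgroup Gb v
    kernel-witness = conjugate-into-kernel p-prime G-subgroup Ga
                       (IsSubgroup.·-closed G-subgroup (^ᶻ-closed G-subgroup Ga u) Gbᵛ) Gbᵛ
                       a-translation aᵘbᵛ-affine bᵛ-linear S≉1
    w : ℕ
    w = proj₁ kernel-witness
    k∈K = proj₂ kernel-witness
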